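{- Every algorithm that computes the operator $\operatorname{OR}$ of a family of input antichains of intervals, and that is only allowed to access the input intervals by comparing their extremes, requires $\Omega(n\log n)$ comparisons in the worst case, where $n$ is the total number of input intervals.
   Context: Let $O$ be a finite totally ordered set. A subset $X\subseteq O$ is an interval if $x,y\in X$ and $x<z<y$ imply $z\in X$; a nonempty interval is written $[\ell\..r]$, where $\ell$ and $r$ are its smallest and largest elements (its left and right extremes). An antichain of intervals is a set of intervals that are pairwise incomparable with respect to inclusion. Given antichains $A_0,\dots,A_{m-1}$, $\operatorname{OR}(A_0,\dots,A_{m-1})$ is the set of inclusion-minimal intervals among those in $A_0\cup\dots\cup A_{m-1}$. The intervals of an antichain are linearly ordered by their left extremes (equivalently, by their right extremes); this is its natural order, and the output antichain is produced as a list of intervals in this order. -}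

module Defs where

open import Data.Nat using (ℕ; zero; suc; _+_; _≤_; _<_)
open import Data.Nat.Properties using (<-cmp)
open import Data.Fin using (Fin; toℕ)
open import Data.List using (List; length; lookup; map)
open import Data.List.Membership.Propositional using (_∈_)
open import Data.List.Relation.Unary.Linked using (Linked)
open import Data.Product using (Σ; ∃; _×_; _,_; proj₁; proj₂)
open import Relation.Binary.PropositionalEquality using (_≡_; _≢_)
open import Relation.Binary.Definitions using (tri<; tri≈; tri>)
open import Relation.Nullary using (¬_)

-- Intervals of the totally ordered set ℕ (any finite
-- totally ordered set embeds order-isomorphically into ℕ).
-- A nonempty interval [ℓ..r] is represented by the pair (ℓ , r), ℓ ≤ r.

Interval : Set
Interval = ℕ × ℕ

left right : Interval → ℕ
left  = proj₁
right = proj₂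

IsInterval : Interval → Set
IsInterval I = left I ≤ right I

_∈I_ : ℕ → Interval → Set
z ∈I I = left I ≤ z × z ≤ right I

_⊆I_ : Interval → Interval → Set
I ⊆I J = ∀ z → z ∈I I → z ∈I J

-- Shape of an input family: m = length s antichains, the i-th of which
-- has lookup s i intervals.  The total number of intervals is sum s.

Shape : Set
Shape = List ℕ

Id : Shape → Set
Id s = Σ (Fin (length s)) λ i → Fin (lookup s i)

data End : Set where
  leftEnd rightEnd : End

Ext : Shape → Set
Ext s = Id s × End

Input : Shape → Set
Input s = Id s → Interval

extreme : (s : Shape) → Input s → Ext s → ℕ
extreme s inp (x , leftEnd)  = left  (inp x)
extreme s inp (x , rightEnd) = right (inp x)

ValidInput : (s : Shape) → Input s → Set
ValidInput s inp =
  (∀ x → IsInterval (inp x)) ×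
  (∀ i (j j′ : Fin (lookup s i)) → j ≢ j′ → ¬ (inp (i , j) ⊆I inp (i , j′))) ×
  (∀ i (j j′ : Fin (lookup s i)) → toℕ j < toℕ j′ →
     left (inp (i , j)) < left (inp (i , j′)))

InUnion : (s : Shape) → Input s → Interval → Set
InUnion s inp I = ∃ λ x → inp x ≡ I

InOR : (s : Shape) → Input s → Interval → Set
InOR s inp I = InUnion s inp I × (∀ J → InUnion s inp J → J ⊆I I → J ≡ I)

IsORList : (s : Shape) → Input s → List Interval → Set
IsORList s inp L =
  (∀ I → (I ∈ L → InOR s inp I) × (InOR s inp I → I ∈ L)) ×
  Linked (λ I J → left I < left J) L

-- Comparison-based algorithms: ternary decision trees whose internal
-- nodes compare two extremes (<, =, >) and whose leaves output a list
-- of intervals, each described by a pair of extremes.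

data DT (X : Set) : Set where
  leaf : List (X × X) → DT X
  ask  : X → X → (lt eq gt : DT X) → DT X

cost : {X : Set} → DT X → (X → ℕ) → ℕ
cost (leaf _) v = zero
cost (ask x y lt eq gt) v with <-cmp (v x) (v y)
... | tri< _ _ _ = suc (cost lt v)
... | tri≈ _ _ _ = suc (cost eq v)
... | tri> _ _ _ = suc (cost gt v)

output : {X : Set} → DT X → (X → ℕ) → List Interval
output (leaf o) v = map (λ p → v (proj₁ p) , v (proj₂ p)) o
output (ask x y lt eq gt) v with <-cmp (v x) (v y)
... | tri< _ _ _ = output lt v
... | tri≈ _ _ _ = output eq v
... | tri> _ _ _ = output gt v

Algorithm : Set
Algorithm = (s : Shape) → DT (Ext s)

ComputesOR : Algorithm → Set
ComputesOR alg = ∀ s (inp : Input s) → ValidInput s inp →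
  IsORList s inp (output (alg s) (extreme s inp))

algCost : Algorithm → (s : Shape) → Input s → ℕ
algCost alg s inp = cost (alg s) (extreme s inp)

-- Sorting reduces to OR: for n singleton antichains [V k..V k] the OR is the
-- set of all n points, listed in increasing order.  Place a ≈ n points so that
-- point j lies strictly inside block d_j, where d_j is the j-th base-b digit of
-- a number below b^a, and let b + 1 further points mark the block boundaries.
-- The sorted output recovers every digit, so the b^a inputs reach pairwise
-- distinct leaves of the ternary decision tree and one of them has depth at
-- least log₃(b^a); with b = 2^(⌊log₂ n⌋ - 2) this is Ω(n log n).
module Submission where

open import Defs
open import Data.Fin using (Fin; zero; suc; toℕ; fromℕ<; cast)
open import Data.Fin.Patterns using (0F; 1F; 2F)
open import Data.Fin.Properties using (any?; pigeonhole; toℕ-fromℕ<; toℕ<n; toℕ-cast; toℕ-injective) renaming (<⇒≢ to <⇒≢ᶠ)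
open import Data.List using (List; map; replicate; length; lookup)
open import Data.List.Membership.Propositional using (_∈_)
open import Data.List.Membership.Propositional.Properties using (∈-map⁻)
open import Data.List.Properties using (length-replicate)
open import Data.List.Relation.Unary.All as All using ()
open import Data.List.Relation.Unary.AllPairs using (AllPairs; _∷_)
open import Data.List.Relation.Unary.Any using (here; there)
open import Data.List.Relation.Unary.Linked as Linked using (Linked)
open import Data.List.Relation.Unary.Linked.Properties using (Linked⇒AllPairs; map⁻)
open import Data.Nat
open import Data.Nat.DivMod
open import Data.Nat.Logarithm using (⌊log₂_⌋; ⌊log₂⌋-mono-≤; ⌊log₂[2^n]⌋≡n)
open import Data.Nat.Logarithm.Core using (⌊log2⌋)
open import Data.Nat.ListAction using (sum)
open import Data.Nat.Properties
open import Data.Nat.Tactic.RingSolver using (solve-∀)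
open import Data.Product using (Σ; ∃; ∃₂; _×_; _,_; proj₁; proj₂)
open import Data.Sum using (_⊎_; inj₁; inj₂; [_,_]′)
open import Function using (_on_; _∘_)
open import Induction.WellFounded using (Acc; acc)
open import Relation.Binary.Definitions using (tri<; tri≈; tri>)
open import Relation.Binary.PropositionalEquality
open import Relation.Nullary using (yes; no; contradiction)

numeral-step : ∀ {b} r c k → r < b → c < b ^ k → r + c * b < b ^ suc k
numeral-step {b} r c k r<b c<b^k = begin-strict
  r + c * b   <⟨ +-monoˡ-< (c * b) r<b ⟩
  suc c * b   ≤⟨ *-monoˡ-≤ b c<b^k ⟩
  b ^ k * b   ≡⟨ *-comm (b ^ k) b ⟩
  b ^ suc k   ∎
  where open ≤-Reasoning

numeral-unique : ∀ {b} r r′ c c′ → r < b → r′ < b → r + c * b ≡ r′ + c′ * b → r ≡ r′ × c ≡ c′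
numeral-unique {b@(suc _)} r r′ c c′ r<b r′<b e = r≡r′ , c≡c′
  where
  r≡r′ : r ≡ r′
  r≡r′ = begin
    r                ≡⟨ m<n⇒m%n≡m r<b ⟨
    r % b            ≡⟨ [m+kn]%n≡m%n r c b ⟨
    (r + c * b) % b  ≡⟨ cong (_% b) e ⟩
    (r′ + c′ * b) % b ≡⟨ [m+kn]%n≡m%n r′ c′ b ⟩
    r′ % b           ≡⟨ m<n⇒m%n≡m r′<b ⟩
    r′               ∎
    where open ≡-Reasoning
  c≡c′ : c ≡ c′
  c≡c′ = *-cancelʳ-≡ c c′ b (+-cancelˡ-≡ r _ _ (trans e (cong (_+ c′ * b) (sym r≡r′))))

ternary-unique : ∀ (r r′ : Fin 3) c c′ → toℕ r + c * 3 ≡ toℕ r′ + c′ * 3 → r ≡ r′ × c ≡ c′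
ternary-unique r r′ c c′ e with numeral-unique (toℕ r) (toℕ r′) c c′ (toℕ<n r) (toℕ<n r′) e
... | r≡r′ , c≡c′ = toℕ-injective r≡r′ , c≡c′

module _ {X : Set} where

  leafOf : DT X → (X → ℕ) → List (X × X)
  leafOf (leaf o) v = o
  leafOf (ask x y lt eq gt) v with <-cmp (v x) (v y)
  ... | tri< _ _ _ = leafOf lt v
  ... | tri≈ _ _ _ = leafOf eq v
  ... | tri> _ _ _ = leafOf gt v

  leafOutput : (X → ℕ) → List (X × X) → List Interval
  leafOutput v = map (λ p → v (proj₁ p) , v (proj₂ p))

  output≡leafOutput : ∀ t v → output t v ≡ leafOutput v (leafOf t v)
  output≡leafOutput (leaf o) v = refl
  output≡leafOutput (ask x y lt eq gt) v with <-cmp (v x) (v y)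
  ... | tri< _ _ _ = output≡leafOutput lt v
  ... | tri≈ _ _ _ = output≡leafOutput eq v
  ... | tri> _ _ _ = output≡leafOutput gt v

  branchCode : DT X → (X → ℕ) → ℕ
  branchCode (leaf _) v = 0
  branchCode (ask x y lt eq gt) v with <-cmp (v x) (v y)
  ... | tri< _ _ _ = 0 + branchCode lt v * 3
  ... | tri≈ _ _ _ = 1 + branchCode eq v * 3
  ... | tri> _ _ _ = 2 + branchCode gt v * 3

  branchCode<3^cost : ∀ t v → branchCode t v < 3 ^ cost t v
  branchCode<3^cost (leaf _) v = z<s
  branchCode<3^cost (ask x y lt eq gt) v with <-cmp (v x) (v y)
  ... | tri< _ _ _ = numeral-step 0 (branchCode lt v) (cost lt v) (s≤s z≤n) (branchCode<3^cost lt v)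
  ... | tri≈ _ _ _ = numeral-step 1 (branchCode eq v) (cost eq v) (s≤s (s≤s z≤n)) (branchCode<3^cost eq v)
  ... | tri> _ _ _ = numeral-step 2 (branchCode gt v) (cost gt v) ≤-refl (branchCode<3^cost gt v)

  branchCode-injective : ∀ t v w → branchCode t v ≡ branchCode t w → leafOf t v ≡ leafOf t w
  branchCode-injective (leaf _) _ _ _ = refl
  branchCode-injective (ask x y lt eq gt) v w e with <-cmp (v x) (v y) | <-cmp (w x) (w y)
  ... | tri< _ _ _ | tri< _ _ _ =
      branchCode-injective lt v w (proj₂ (ternary-unique 0F 0F (branchCode lt v) (branchCode lt w) e))
  ... | tri< _ _ _ | tri≈ _ _ _ =
      contradiction (proj₁ (ternary-unique 0F 1F (branchCode lt v) (branchCode eq w) e)) λ ()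
  ... | tri< _ _ _ | tri> _ _ _ =
      contradiction (proj₁ (ternary-unique 0F 2F (branchCode lt v) (branchCode gt w) e)) λ ()
  ... | tri≈ _ _ _ | tri< _ _ _ =
      contradiction (proj₁ (ternary-unique 1F 0F (branchCode eq v) (branchCode lt w) e)) λ ()
  ... | tri≈ _ _ _ | tri≈ _ _ _ =
      branchCode-injective eq v w (proj₂ (ternary-unique 1F 1F (branchCode eq v) (branchCode eq w) e))
  ... | tri≈ _ _ _ | tri> _ _ _ =
      contradiction (proj₁ (ternary-unique 1F 2F (branchCode eq v) (branchCode gt w) e)) λ ()
  ... | tri> _ _ _ | tri< _ _ _ =
      contradiction (proj₁ (ternary-unique 2F 0F (branchCode gt v) (branchCode lt w) e)) λ ()
  ... | tri> _ _ _ | tri≈ _ _ _ =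
      contradiction (proj₁ (ternary-unique 2F 1F (branchCode gt v) (branchCode eq w) e)) λ ()
  ... | tri> _ _ _ | tri> _ _ _ =
      branchCode-injective gt v w (proj₂ (ternary-unique 2F 2F (branchCode gt v) (branchCode gt w) e))

  deepOrCollision : ∀ {K} D (t : DT X) (v : Fin K → X → ℕ) → 3 ^ D < K →
    (∃ λ F → D ≤ cost t (v F)) ⊎ (∃₂ λ F G → F ≢ G × leafOf t (v F) ≡ leafOf t (v G))
  deepOrCollision D t v 3^D<K with any? (λ F → D ≤? cost t (v F))
  ... | yes deep = inj₁ deep
  ... | no shallow with pigeonhole 3^D<K (λ F → fromℕ< (code<3^D F))
    where
    code<3^D : ∀ F → branchCode t (v F) < 3 ^ D
    code<3^D F = <-≤-trans (branchCode<3^cost t (v F))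
                           (^-monoʳ-≤ 3 (<⇒≤ (≰⇒> λ D≤cost → shallow (F , D≤cost))))
  ... | F , G , F<G , sameCode = inj₂ (F , G , <⇒≢ᶠ F<G , branchCode-injective t (v F) (v G) codesAgree)
    where
    codesAgree : branchCode t (v F) ≡ branchCode t (v G)
    codesAgree = trans (sym (toℕ-fromℕ< _)) (trans (cong toℕ sameCode) (toℕ-fromℕ< _))

digit : (b : ℕ) .{{_ : NonZero b}} → ℕ → ℕ → ℕ
digit b x zero    = x % b
digit b x (suc j) = digit b (x / b) j

digit<base : ∀ b .{{_ : NonZero b}} x j → digit b x j < b
digit<base b x zero    = m%n<n x b
digit<base b x (suc j) = digit<base b (x / b) j

digit-injective : ∀ b .{{_ : NonZero b}} a x y → x < b ^ a → y < b ^ a →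
  (∀ j → j < a → digit b x j ≡ digit b y j) → x ≡ y
digit-injective b zero x y x<1 y<1 _ = trans (n<1⇒n≡0 x<1) (sym (n<1⇒n≡0 y<1))
digit-injective b (suc a) x y x<b^1+a y<b^1+a sameDigits = begin
  x                   ≡⟨ m≡m%n+[m/n]*n x b ⟩
  x % b + (x / b) * b ≡⟨ cong₂ (λ r q → r + q * b) (sameDigits zero z<s) sameQuotient ⟩
  y % b + (y / b) * b ≡⟨ m≡m%n+[m/n]*n y b ⟨
  y                   ∎
  where
  open ≡-Reasoning
  quotient< : ∀ z → z < b ^ suc a → z / b < b ^ a
  quotient< z z< = m<n*o⇒m/o<n (subst (z <_) (*-comm b (b ^ a)) z<)
  sameQuotient : x / b ≡ y / b
  sameQuotient = digit-injective b a (x / b) (y / b) (quotient< x x<b^1+a) (quotient< y y<b^1+a)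
                   (λ j j<a → sameDigits (suc j) (s≤s j<a))

module _ {A : Set} (f g : A → ℕ) where

  private
    _≺_ : A → A → Set
    p ≺ q = f p < f q × g p < g q

    ≺-trans : ∀ {p q r} → p ≺ q → q ≺ r → p ≺ r
    ≺-trans (fpq , gpq) (fqr , gqr) = <-trans fpq fqr , <-trans gpq gqr

    sorted-both : ∀ {xs} → Linked (_<_ on f) xs → Linked (_<_ on g) xs → Linked _≺_ xs
    sorted-both Linked.[]  _ = Linked.[]
    sorted-both Linked.[-] _ = Linked.[-]
    sorted-both (fxy Linked.∷ fs) (gxy Linked.∷ gs) = (fxy , gxy) Linked.∷ sorted-both fs gs

    ≺-members : ∀ {xs p q} → AllPairs _≺_ xs → p ∈ xs → q ∈ xs → f p < f q → g p < g q
    ≺-members (_ ∷ _)  (here refl) (here refl) fp<fq = contradiction fp<fq (<-irrefl refl)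
    ≺-members (p≺ ∷ _) (here refl) (there q∈) _     = proj₂ (All.lookup p≺ q∈)
    ≺-members (q≺ ∷ _) (there p∈) (here refl) fp<fq = contradiction fp<fq (<-asym (proj₁ (All.lookup q≺ p∈)))
    ≺-members (_ ∷ ps) (there p∈) (there q∈) fp<fq = ≺-members ps p∈ q∈ fp<fq

  sortedTwice⇒orderAgrees : ∀ {xs p q} → Linked (_<_ on f) xs → Linked (_<_ on g) xs →
    p ∈ xs → q ∈ xs → f p < f q → g p < g q
  sortedTwice⇒orderAgrees fs gs = ≺-members (Linked⇒AllPairs ≺-trans (sorted-both fs gs))

singletons : ℕ → Shape
singletons n = replicate n 1

sum-singletons : ∀ n → sum (singletons n) ≡ n
sum-singletons zero    = refl
sum-singletons (suc n) = cong suc (sum-singletons n)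

onlyPosition : ∀ n i → Fin (lookup (singletons n) i)
onlyPosition (suc n) zero    = zero
onlyPosition (suc n) (suc i) = onlyPosition n i

position-unique : ∀ n i (j j′ : Fin (lookup (singletons n) i)) → j ≡ j′
position-unique (suc n) zero    zero zero = refl
position-unique (suc n) (suc i) j    j′   = position-unique n i j j′

antichainAt : ∀ n k → k < n → Σ (Fin (length (singletons n))) λ i → toℕ i ≡ k
antichainAt n k k<n = cast (sym (length-replicate n)) (fromℕ< k<n) , trans (toℕ-cast _ _) (toℕ-fromℕ< k<n)

antichainIndex : ∀ n → Ext (singletons n) → ℕ
antichainIndex n ((i , _) , _) = toℕ i

point : ℕ → Interval
point x = x , x

pointInput : ∀ n → (ℕ → ℕ) → Input (singletons n)
pointInput n V (i , _) = point (V (toℕ i))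

pointInput-valid : ∀ n V → ValidInput (singletons n) (pointInput n V)
pointInput-valid n V =
  (λ _ → ≤-refl) ,
  (λ i j j′ j≢j′ _ → j≢j′ (position-unique n i j j′)) ,
  (λ i j j′ j<j′ → contradiction (cong toℕ (position-unique n i j j′)) (<⇒≢ j<j′))

module _ (n : ℕ) (V : ℕ → ℕ) where

  private
    s = singletons n
    v = extreme s (pointInput n V)

  extreme-pointInput : ∀ e → v e ≡ V (antichainIndex n e)
  extreme-pointInput (_ , leftEnd)  = refl
  extreme-pointInput (_ , rightEnd) = refl

  point∈OR : ∀ k → k < n → InOR s (pointInput n V) (point (V k))
  point∈OR k k<n = ((i , onlyPosition n i) , cong (point ∘ V) i≡k) , minimal
    where
    i = proj₁ (antichainAt n k k<n)
    i≡k = proj₂ (antichainAt n k k<n)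
    minimal : ∀ J → InUnion s (pointInput n V) J → J ⊆I point (V k) → J ≡ point (V k)
    minimal _ ((i′ , _) , refl) J⊆ with J⊆ (V (toℕ i′)) (≤-refl , ≤-refl)
    ... | Vk≤ , ≤Vk = cong point (≤-antisym ≤Vk Vk≤)

  module _ (o : List (Ext s × Ext s)) (isOR : IsORList s (pointInput n V) (leafOutput v o)) where

    orList-sorted : Linked (_<_ on (λ p → V (antichainIndex n (proj₁ p)))) o
    orList-sorted =
      Linked.map (λ {p} {q} → subst₂ _<_ (extreme-pointInput (proj₁ p)) (extreme-pointInput (proj₁ q)))
                 (map⁻ (proj₂ isOR))

    orList-complete : (∀ {k k′} → V k ≡ V k′ → k ≡ k′) →
      ∀ k → k < n → ∃ λ p → p ∈ o × antichainIndex n (proj₁ p) ≡ k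
    orList-complete V-injective k k<n
      with ∈-map⁻ _ (proj₂ (proj₁ isOR (point (V k))) (point∈OR k k<n))
    ... | p , p∈o , Vk≡ = p , p∈o , sym (V-injective (trans (cong proj₁ Vk≡) (extreme-pointInput (proj₁ p))))

sharedOutput⇒sameOrder : ∀ n V W → (∀ {k k′} → V k ≡ V k′ → k ≡ k′) →
  (o : List (Ext (singletons n) × Ext (singletons n))) →
  IsORList (singletons n) (pointInput n V) (leafOutput (extreme _ (pointInput n V)) o) →
  IsORList (singletons n) (pointInput n W) (leafOutput (extreme _ (pointInput n W)) o) →
  ∀ k k′ → k < n → k′ < n → V k < V k′ → W k < W k′
sharedOutput⇒sameOrder n V W V-injective o orV orW k k′ k<n k′<n Vk<Vk′
  with orList-complete n V o orV V-injective k k<n | orList-complete n V o orV V-injective k′ k′<n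
... | p , p∈o , refl | q , q∈o , refl =
  sortedTwice⇒orderAgrees _ _ (orList-sorted n V o orV) (orList-sorted n W o orW) p∈o q∈o Vk<Vk′

-- Points k < a lie strictly inside the block [d k (a + 1) .. (d k + 1)(a + 1)];
-- point a + m is the block boundary m (a + 1).
place : ℕ → (ℕ → ℕ) → ℕ → ℕ
place a d k with k <? a
... | yes _ = suc k + d k * suc a
... | no  _ = (k ∸ a) * suc a

place-inside : ∀ a d {k} → k < a → place a d k ≡ suc k + d k * suc a
place-inside a d {k} k<a with k <? a
... | yes _   = refl
... | no  k≮a = contradiction k<a k≮a

place-outside : ∀ a d {k} → a ≤ k → place a d k ≡ (k ∸ a) * suc a
place-outside a d {k} a≤k with k <? a
... | yes k<a = contradiction k<a (≤⇒≯ a≤k)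
... | no  _   = refl

place-boundary : ∀ a d m → place a d (a + m) ≡ m * suc a
place-boundary a d m = trans (place-outside a d (m≤m+n a m)) (cong (_* suc a) (m+n∸m≡n a m))

place-injective : ∀ a d {k k′} → place a d k ≡ place a d k′ → k ≡ k′
place-injective a d {k} {k′} e with k <? a | k′ <? a
... | yes k<a | yes k′<a =
  suc-injective (proj₁ (numeral-unique (suc k) (suc k′) (d k) (d k′) (s≤s k<a) (s≤s k′<a) e))
... | yes k<a | no  _    =
  contradiction (proj₁ (numeral-unique (suc k) 0 (d k) (k′ ∸ a) (s≤s k<a) z<s e)) λ ()
... | no  _   | yes k′<a =
  contradiction (proj₁ (numeral-unique 0 (suc k′) (k ∸ a) (d k′) z<s (s≤s k′<a) e)) λ ()
... | no  k≮a | no  k′≮a = begin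
  k         ≡⟨ m∸n+n≡m (≮⇒≥ k≮a) ⟨
  k ∸ a + a  ≡⟨ cong (_+ a) (proj₂ (numeral-unique 0 0 (k ∸ a) (k′ ∸ a) z<s z<s e)) ⟩
  k′ ∸ a + a ≡⟨ m∸n+n≡m (≮⇒≥ k′≮a) ⟩
  k′        ∎
  where open ≡-Reasoning

inside<boundary : ∀ a d {j m} → j < a → d j < m → place a d j < place a d (a + m)
inside<boundary a d {j} {m} j<a dj<m = begin-strict
  place a d j              ≡⟨ place-inside a d j<a ⟩
  suc j + d j * suc a      <⟨ +-monoˡ-< (d j * suc a) (s≤s j<a) ⟩
  suc (d j) * suc a        ≤⟨ *-monoˡ-≤ (suc a) dj<m ⟩
  m * suc a                ≡⟨ place-boundary a d m ⟨
  place a d (a + m)        ∎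
  where open ≤-Reasoning

boundary<inside : ∀ a d {j m} → j < a → m ≤ d j → place a d (a + m) < place a d j
boundary<inside a d {j} {m} j<a m≤dj = begin-strict
  place a d (a + m)        ≡⟨ place-boundary a d m ⟩
  m * suc a                ≤⟨ *-monoˡ-≤ (suc a) m≤dj ⟩
  d j * suc a              <⟨ s≤s (m≤n+m (d j * suc a) j) ⟩
  suc j + d j * suc a      ≡⟨ place-inside a d j<a ⟨
  place a d j              ∎
  where open ≤-Reasoning

-- Under d, point j lies below boundary a + m exactly when d j < m, so the
-- boundaries a + 1 + d₁ j and a + 1 + d₂ j tell d₁ j and d₂ j apart.
sameOrder⇒sameDigits : ∀ a b n d₁ d₂ → a + b < n → (∀ j → d₁ j < b) → (∀ j → d₂ j < b) →
  (∀ k k′ → k < n → k′ < n → place a d₁ k < place a d₁ k′ → place a d₂ k < place a d₂ k′) →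
  ∀ j → j < a → d₁ j ≡ d₂ j
sameOrder⇒sameDigits a b n d₁ d₂ a+b<n d₁<b d₂<b sameOrder j j<a =
  ≤-antisym (≮⇒≥ d₂j≮d₁j) (≮⇒≥ d₁j≮d₂j)
  where
  j<n : j < n
  j<n = <-trans (≤-trans j<a (m≤m+n a b)) a+b<n
  boundary<n : ∀ d → (∀ i → d i < b) → a + suc (d j) < n
  boundary<n d d<b = ≤-<-trans (+-monoʳ-≤ a (d<b j)) a+b<n
  d₁j≮d₂j : d₁ j ≮ d₂ j
  d₁j≮d₂j d₁j<d₂j = <-asym
    (sameOrder j (a + suc (d₁ j)) j<n (boundary<n d₁ d₁<b) (inside<boundary a d₁ j<a ≤-refl))
    (boundary<inside a d₂ j<a d₁j<d₂j)
  d₂j≮d₁j : d₂ j ≮ d₁ j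
  d₂j≮d₁j d₂j<d₁j = <-asym
    (sameOrder (a + suc (d₂ j)) j (boundary<n d₂ d₂<b) j<n (boundary<inside a d₁ j<a d₂j<d₁j))
    (inside<boundary a d₂ j<a ≤-refl)

2^⌊log2⌋≤n : ∀ n (rec : Acc _<_ n) → 1 ≤ n → 2 ^ ⌊log2⌋ n rec ≤ n
2^⌊log2⌋≤n (suc zero)    _       _ = ≤-refl
2^⌊log2⌋≤n (suc (suc n)) (acc _) _ = begin
  2 * 2 ^ ⌊log2⌋ (suc ⌊ n /2⌋) _ ≤⟨ *-monoʳ-≤ 2 (2^⌊log2⌋≤n (suc ⌊ n /2⌋) _ (s≤s z≤n)) ⟩
  2 * suc ⌊ n /2⌋                ≡⟨ *-suc 2 ⌊ n /2⌋ ⟩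
  2 + 2 * ⌊ n /2⌋                ≤⟨ +-monoʳ-≤ 2 twice⌊n/2⌋≤n ⟩
  2 + n                          ∎
  where
  open ≤-Reasoning
  twice⌊n/2⌋≤n : 2 * ⌊ n /2⌋ ≤ n
  twice⌊n/2⌋≤n = begin
    2 * ⌊ n /2⌋          ≡⟨ cong (⌊ n /2⌋ +_) (+-identityʳ ⌊ n /2⌋) ⟩
    ⌊ n /2⌋ + ⌊ n /2⌋    ≤⟨ +-monoʳ-≤ ⌊ n /2⌋ (⌊n/2⌋≤⌈n/2⌉ n) ⟩
    ⌊ n /2⌋ + ⌈ n /2⌉    ≡⟨ ⌊n/2⌋+⌈n/2⌉≡n n ⟩
    n                    ∎

2^⌊log₂n⌋≤n : ∀ n → 1 ≤ n → 2 ^ ⌊log₂ n ⌋ ≤ n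
2^⌊log₂n⌋≤n n = 2^⌊log2⌋≤n n _

m≤2n*[m/n] : ∀ m n .{{_ : NonZero n}} → n ≤ m → m ≤ 2 * n * (m / n)
m≤2n*[m/n] m n n≤m = begin
  m                   ≡⟨ m≡m%n+[m/n]*n m n ⟩
  m % n + m / n * n   ≤⟨ +-monoˡ-≤ (m / n * n) (<⇒≤ (m%n<n m n)) ⟩
  n + m / n * n       ≤⟨ +-monoˡ-≤ (m / n * n) (m≤n*m n (m / n) {{>-nonZero (m≥n⇒m/n>0 n≤m)}}) ⟩
  m / n * n + m / n * n ≡⟨ double n (m / n) ⟩
  2 * n * (m / n)     ∎
  where
  open ≤-Reasoning
  double : ∀ n q → q * n + q * n ≡ 2 * n * q
  double = solve-∀

2D<Ma : ∀ n L M a D → D * 32 ≤ n * L → L ≤ 2 * M → n ≤ 2 * a → 0 < n * L → 2 * D < M * a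
2D<Ma n L M a D 32D≤nL L≤2M n≤2a 0<nL = *-cancelˡ-< 32 (2 * D) (M * a) (begin-strict
  32 * (2 * D)           ≡⟨ e₁ D ⟩
  2 * (D * 32)           ≤⟨ *-monoʳ-≤ 2 32D≤nL ⟩
  2 * (n * L)            <⟨ *-monoˡ-< (n * L) {{>-nonZero 0<nL}} {2} {8} (s<s (s<s z<s)) ⟩
  8 * (n * L)            ≤⟨ *-monoʳ-≤ 8 (*-mono-≤ n≤2a L≤2M) ⟩
  8 * (2 * a * (2 * M))  ≡⟨ e₂ a M ⟩
  32 * (M * a)           ∎)
  where
  open ≤-Reasoning
  e₁ : ∀ D → 32 * (2 * D) ≡ 2 * (D * 32)
  e₁ = solve-∀
  e₂ : ∀ a M → 8 * (2 * a * (2 * M)) ≡ 32 * (M * a)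
  e₂ = solve-∀

module HardFamily (n : ℕ) (16≤n : 16 ≤ n) where

  L M b a D K : ℕ
  L = ⌊log₂ n ⌋
  M = L ∸ 2
  b = 2 ^ M
  a = n ∸ suc b
  D = n * L / 32
  K = b ^ a

  instance
    b≢0 : NonZero b
    b≢0 = m^n≢0 2 M

  4≤L : 4 ≤ L
  4≤L = subst (_≤ L) (⌊log₂[2^n]⌋≡n 4) (⌊log₂⌋-mono-≤ 16≤n)

  2+M≡L : 2 + M ≡ L
  2+M≡L = m+[n∸m]≡n (≤-trans (s≤s (s≤s z≤n)) 4≤L)

  1≤b : 1 ≤ b
  1≤b = m^n>0 2 M

  4b≤n : 4 * b ≤ n
  4b≤n = begin
    4 * b        ≡⟨ ^-distribˡ-+-* 2 2 M ⟨
    2 ^ (2 + M)  ≡⟨ cong (2 ^_) 2+M≡L ⟩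
    2 ^ L        ≤⟨ 2^⌊log₂n⌋≤n n (≤-trans (s≤s z≤n) 16≤n) ⟩
    n            ∎
    where open ≤-Reasoning

  2+2b≤n : 2 + (b + b) ≤ n
  2+2b≤n = begin
    2 + (b + b)        ≤⟨ +-monoˡ-≤ (b + b) (+-mono-≤ 1≤b 1≤b) ⟩
    (b + b) + (b + b)  ≡⟨ e b ⟩
    4 * b              ≤⟨ 4b≤n ⟩
    n                  ∎
    where
    open ≤-Reasoning
    e : ∀ b → (b + b) + (b + b) ≡ 4 * b
    e = solve-∀

  a+1+b≡n : a + suc b ≡ n
  a+1+b≡n = m∸n+n≡m (≤-trans (s≤s (≤-trans (m≤m+n b b) (n≤1+n (b + b)))) 2+2b≤n)

  a+b<n : a + b < n
  a+b<n = subst (a + b <_) a+1+b≡n (+-monoʳ-< a ≤-refl)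

  n≤2a : n ≤ 2 * a
  n≤2a = +-cancelʳ-≤ n n (2 * a) (begin
    n + n                      ≡⟨ cong₂ _+_ a+1+b≡n a+1+b≡n ⟨
    (a + suc b) + (a + suc b)  ≡⟨ e a b ⟩
    2 * a + (2 + (b + b))      ≤⟨ +-monoʳ-≤ (2 * a) 2+2b≤n ⟩
    2 * a + n                  ∎)
    where
    open ≤-Reasoning
    e : ∀ a b → (a + suc b) + (a + suc b) ≡ 2 * a + (2 + (b + b))
    e = solve-∀

  L≤2M : L ≤ 2 * M
  L≤2M = begin
    L         ≡⟨ 2+M≡L ⟨
    2 + M     ≤⟨ +-monoˡ-≤ M (∸-monoˡ-≤ 2 4≤L) ⟩
    M + M     ≡⟨ cong (M +_) (+-identityʳ M) ⟨
    2 * M     ∎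
    where open ≤-Reasoning

  64≤nL : 64 ≤ n * L
  64≤nL = *-mono-≤ 16≤n 4≤L

  3^D<K : 3 ^ D < K
  3^D<K = begin-strict
    3 ^ D        ≤⟨ ^-monoˡ-≤ D (s≤s (s≤s (s≤s z≤n))) ⟩
    (2 ^ 2) ^ D  ≡⟨ ^-*-assoc 2 2 D ⟩
    2 ^ (2 * D)  <⟨ ^-monoʳ-< 2 ≤-refl depth-fits ⟩
    2 ^ (M * a)  ≡⟨ ^-*-assoc 2 M a ⟨
    K            ∎
    where
    open ≤-Reasoning
    depth-fits : 2 * D < M * a
    depth-fits = 2D<Ma n L M a D (m/n*n≤m (n * L) 32) L≤2M n≤2a (≤-trans (s≤s z≤n) 64≤nL)

  nL≤64D : n * L ≤ 64 * D
  nL≤64D = m≤2n*[m/n] (n * L) 32 (≤-trans (m≤n+m 32 32) 64≤nL)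

  digits : Fin K → ℕ → ℕ
  digits F = digit b (toℕ F)

  input : Fin K → Input (singletons n)
  input F = pointInput n (place a (digits F))

  input-valid : ∀ F → ValidInput (singletons n) (input F)
  input-valid F = pointInput-valid n (place a (digits F))

  valuation : Fin K → Ext (singletons n) → ℕ
  valuation F = extreme (singletons n) (input F)

  module _ (alg : Algorithm) (correct : ComputesOR alg) where

    private
      t = alg (singletons n)

    leafIsOR : ∀ F → IsORList (singletons n) (input F) (leafOutput (valuation F) (leafOf t (valuation F)))
    leafIsOR F = subst (IsORList (singletons n) (input F)) (output≡leafOutput t (valuation F))
                       (correct (singletons n) (input F) (input-valid F))

    sameLeaf⇒sameInput : ∀ F G → leafOf t (valuation F) ≡ leafOf t (valuation G) → F ≡ G
    sameLeaf⇒sameInput F G sameLeaf =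
      toℕ-injective (digit-injective b a (toℕ F) (toℕ G) (toℕ<n F) (toℕ<n G) sameDigits)
      where
      o = leafOf t (valuation F)
      leafIsOR-G : IsORList (singletons n) (input G) (leafOutput (valuation G) o)
      leafIsOR-G = subst (λ o′ → IsORList (singletons n) (input G) (leafOutput (valuation G) o′))
                         (sym sameLeaf) (leafIsOR G)
      sameOrder : ∀ k k′ → k < n → k′ < n →
        place a (digits F) k < place a (digits F) k′ → place a (digits G) k < place a (digits G) k′
      sameOrder = sharedOutput⇒sameOrder n (place a (digits F)) (place a (digits G))
                    (place-injective a (digits F)) o (leafIsOR F) leafIsOR-G
      sameDigits : ∀ j → j < a → digits F j ≡ digits G j
      sameDigits = sameOrder⇒sameDigits a b n (digits F) (digits G) a+b<n
                     (digit<base b (toℕ F)) (digit<base b (toℕ G)) sameOrder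

mainTheorem1 : Σ ℕ λ d → Σ ℕ λ N → (alg : Algorithm) → ComputesOR alg →
    (n : ℕ) → N ≤ n →
    Σ Shape λ s → sum s ≡ n × Σ (Input s) λ inp → ValidInput s inp ×
      n * ⌊log₂ n ⌋ ≤ d * algCost alg s inp
mainTheorem1 = 64 , 16 , λ alg correct n 16≤n →
  let open HardFamily n 16≤n in
  [ (λ { (F , D≤cost) → singletons n , sum-singletons n , input F , input-valid F ,
                         ≤-trans nL≤64D (*-monoʳ-≤ 64 D≤cost) })
  , (λ { (F , G , F≢G , sameLeaf) → contradiction (sameLeaf⇒sameInput alg correct F G sameLeaf) F≢G })
  ]′ (deepOrCollision D (alg (singletons n)) valuation 3^D<K)
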